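{- Let $G$ be an edge-maximal distance critical graph and let $S$ be the set of vertices of $G$ that are involved in some determining pair (that is, $u \in S$ iff there are vertices $w,v$ with $\{u,w\}$ a determining pair for $v$ in $G$). Then for every pair of distinct nonadjacent vertices $x,y$ of $G$, $\{x,y\} \cap S \neq \emptyset$.
   Context: All graphs are finite, simple and undirected. For vertices $x,y$ of a graph $G$, $d_G(x,y)$ is the length of a shortest path from $x$ to $y$ in $G$ ($\infty$ if none exists). A graph $G$ is distance critical if for every vertex $v \in V(G)$ there exist vertices $x,y \in V(G)\setminus\{v\}$ with $d_G(x,y) \neq d_{G-v}(x,y)$. $G$ is edge-maximal distance critical if $G$ is distance critical and for every pair of distinct nonadjacent vertices $x,y$, the graph $G+xy$ is not distance critical. A pair of vertices $\{a,b\}$ is a determining pair for a vertex $v$ if $a$ and $b$ are distinct and nonadjacent and $v$ is their unique common neighbor. -}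

module Defs where

open import Data.Nat using (ℕ; zero; suc)
open import Data.Fin using (Fin; punchIn)
open import Data.Fin.Properties using () renaming (_≟_ to _≟ᶠ_)
open import Data.Bool using (Bool; true; false; _∨_; _∧_; if_then_else_)
open import Data.Bool.ListAction using (any)
open import Data.Maybe using (Maybe; just; nothing)
open import Data.List using (allFin)
open import Relation.Nullary.Decidable using (⌊_⌋)
open import Relation.Binary.PropositionalEquality using (_≡_; _≢_; refl)
open import Data.Product using (_×_; ∃-syntax)

-- A (loopless, undirected) graph on the vertex set Fin n, given by a
-- Bool-valued adjacency function.  Simplicity (symmetry, irreflexivity)
-- is the predicate IsSimpleGraph below.
record Graph : Set where
  constructor mkGraph
  field
    n   : ℕ
    adj : Fin n → Fin n → Bool
open Graph public

V : Graph → Set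
V G = Fin (n G)

IsSimpleGraph : Graph → Set
IsSimpleGraph G = (∀ x y → adj G x y ≡ adj G y x) × (∀ x → adj G x x ≡ false)

Adj : (G : Graph) → V G → V G → Set
Adj G x y = adj G x y ≡ true

NonAdj : (G : Graph) → V G → V G → Set
NonAdj G x y = adj G x y ≡ false

reach : (G : Graph) → ℕ → V G → V G → Bool
reach G zero    x y = ⌊ x ≟ᶠ y ⌋
reach G (suc k) x y = reach G k x y ∨ any (λ z → adj G x z ∧ reach G k z y) (allFin (n G))

-- Extended naturals: nothing = ∞.
ℕ∞ : Set
ℕ∞ = Maybe ℕ

search : (G : Graph) → V G → V G → ℕ → ℕ → ℕ∞
search G x y i zero       = nothing
search G x y i (suc fuel) =
  if reach G i x y then just i else search G x y (suc i) fuel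

-- d_G(x,y): length of a shortest x–y path, ∞ (nothing) if none.  A
-- shortest path has length < n, so searching k = 0,…,n-1 suffices.
dist : (G : Graph) → V G → V G → ℕ∞
dist G x y = search G x y 0 (n G)

-- G - v (vertex deletion), for G with n = suc m vertices; vertex i of
-- G - v is the vertex  punchIn v i  of G (punchIn v ranges over V G ∖ {v}).
delete : (m : ℕ) (adjG : Fin (suc m) → Fin (suc m) → Bool) → Fin (suc m) → Graph
delete m adjG v = mkGraph m (λ i j → adjG (punchIn v i) (punchIn v j))

DistanceCritical : Graph → Set
DistanceCritical (mkGraph zero    a) = Data.Unit.⊤
  where import Data.Unit
DistanceCritical (mkGraph (suc m) a) = ∀ (v : Fin (suc m)) →
  ∃[ i ] ∃[ j ] (dist (mkGraph (suc m) a) (punchIn v i) (punchIn v j)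
                  ≢ dist (delete m a v) i j)

addEdge : (G : Graph) → V G → V G → Graph
addEdge G x y = mkGraph (n G) (λ a b →
  adj G a b ∨ ((⌊ a ≟ᶠ x ⌋ ∧ ⌊ b ≟ᶠ y ⌋) ∨ (⌊ a ≟ᶠ y ⌋ ∧ ⌊ b ≟ᶠ x ⌋)))

EdgeMaximalDistanceCritical : Graph → Set
EdgeMaximalDistanceCritical G =
  DistanceCritical G ×
  (∀ x y → x ≢ y → NonAdj G x y → ¬ DistanceCritical (addEdge G x y))
  where open import Relation.Nullary using (¬_)

DeterminingPair : (G : Graph) → V G → V G → V G → Set
DeterminingPair G a b v =
  a ≢ b × NonAdj G a b × Adj G a v × Adj G b v ×
  (∀ w → Adj G a w → Adj G b w → w ≡ v)

InS : (G : Graph) → V G → Set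
InS G u = ∃[ w ] ∃[ v ] DeterminingPair G u w v

{-# OPTIONS --safe #-}

-- Deleting v changes some distance iff v has a determining pair.  If {p, q} is
-- one, then d(p, q) = 2 and every p–q walk of length ≤ 2 passes through v.
-- Conversely, if no pair of neighbours of v is determining, each passage
-- s – v – t of a walk can be replaced by s = t, an edge st, or s – w – t with
-- w ≠ v, so deleting v changes no distance.  Now let x, y be nonadjacent and
-- both outside S.  Then every determining pair of G avoids x and y, so it stays
-- determining in G + xy; every vertex stays critical, and G + xy is distance
-- critical, contradicting edge-maximality.

module Submission where

open import Defs
open import Data.Bool using (Bool; true; false; T; _∧_; _∨_)
open import Data.Bool.Properties using (T-∨; T-∧; T-≡; ∨-comm; ∧-comm; ∨-identityʳ)
  renaming (_≟_ to _≟ᵇ_)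
open import Data.Empty using (⊥-elim)
open import Data.Fin as Fin using (Fin; zero; suc; toℕ; punchIn; punchOut)
open import Data.Fin.Properties
  using (pigeonhole; punchIn-injective; punchInᵢ≢i; punchIn-punchOut; any?; all?; _≟_)
open import Data.List using (allFin)
open import Data.List.Membership.Propositional using (lose)
open import Data.List.Membership.Propositional.Properties using (∈-allFin)
open import Data.List.Relation.Unary.Any using (satisfied)
open import Data.List.Relation.Unary.Any.Properties using (any⁺; any⁻)
open import Data.Maybe using (just; nothing)
open import Data.Nat using (ℕ; zero; suc; _+_; _∸_; _≤_; _<_; z≤n; s≤s; _<?_)
open import Data.Nat.Induction using (<-wellFounded)
open import Data.Nat.Properties
  using (≤-refl; ≤-trans; ≤-antisym; <⇒≤; ≮⇒≥; <⇒≱; m≤n⇒m≤1+n; m∸n≤m;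
         m≤n⇒m<n∨m≡n; +-suc; +-identityʳ; +-mono-≤)
open import Data.Product using (_×_; ∃-syntax; _,_; proj₁)
open import Data.Sum using (_⊎_; inj₁; inj₂)
open import Function using (_∘_)
open import Function.Bundles using (Equivalence)
open import Induction.WellFounded using (Acc; acc)
open import Relation.Binary.PropositionalEquality
  using (_≡_; _≢_; refl; sym; trans; cong; cong₂; subst; subst₂)
open import Relation.Nullary using (¬_; Dec; yes; no; contradiction)
open import Relation.Nullary.Decidable
  using (⌊_⌋; toWitness; fromWitness; ¬?; _×-dec_; _→-dec_; decidable-stable)

open Equivalence using (to; from)

data Walk (G : Graph) : V G → V G → ℕ → Set where
  []  : ∀ {x} → Walk G x x 0
  _∷_ : ∀ {x y z l} → Adj G x z → Walk G z y l → Walk G x y (suc l)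

infixr 5 _∷_ _++_

_++_ : ∀ {G x y z l l′} → Walk G x y l → Walk G y z l′ → Walk G x z (l + l′)
[]      ++ q = q
(e ∷ p) ++ q = e ∷ (p ++ q)

reach-sound : ∀ {G x y} k → T (reach G k x y) → ∃[ l ] l ≤ k × Walk G x y l
reach-sound zero h with toWitness h
... | refl = 0 , z≤n , []
reach-sound {G} (suc k) h with T-∨ .to h
... | inj₁ r = let l , l≤k , p = reach-sound k r in l , m≤n⇒m≤1+n l≤k , p
... | inj₂ r with satisfied (any⁻ _ (allFin (n G)) r)
...   | _ , x∼z∧r = let x∼z , r′ = T-∧ .to x∼z∧r
                        l , l≤k , p = reach-sound k r′
                    in suc l , s≤s l≤k , T-≡ .to x∼z ∷ p

reach-complete : ∀ {G x y l} k → Walk G x y l → l ≤ k → T (reach G k x y)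
reach-complete zero [] z≤n = fromWitness refl
reach-complete {G} {x} (suc k) [] _ =
  T-∨ {reach G k x x} .from (inj₁ (reach-complete k [] z≤n))
reach-complete {G} {x} {y} (suc k) (x∼z ∷ p) (s≤s l≤k) =
  T-∨ {reach G k x y} .from (inj₂ (any⁺ (λ z → adj G x z ∧ reach G k z y)
    (lose (∈-allFin _) (T-∧ .from (T-≡ .from x∼z , reach-complete k p l≤k)))))

vertexAt : ∀ {G x y l} → Walk G x y l → Fin (suc l) → V G
vertexAt {x = x} p       zero    = x
vertexAt         (_ ∷ p) (suc j) = vertexAt p j

dropWalk : ∀ {G x y l} (p : Walk G x y l) (j : Fin (suc l)) →
           Walk G (vertexAt p j) y (l ∸ toℕ j)
dropWalk p       zero    = p
dropWalk (_ ∷ p) (suc j) = dropWalk p j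

cutLoop : ∀ {G x y l} (p : Walk G x y l) {i j : Fin (suc l)} →
          i Fin.< j → vertexAt p i ≡ vertexAt p j → ∃[ l′ ] l′ < l × Walk G x y l′
cutLoop {G} {y = y} (_ ∷ p) {zero} {suc j} _ x≡pⱼ =
  _ , s≤s (m∸n≤m _ (toℕ j)) , subst (λ w → Walk G w y _) (sym x≡pⱼ) (dropWalk p j)
cutLoop (e ∷ p) {suc i} {suc j} (s≤s i<j) pᵢ≡pⱼ =
  let l′ , l′<l , q = cutLoop p i<j pᵢ≡pⱼ in suc l′ , s≤s l′<l , e ∷ q

shortcut : ∀ {G x y l} → Walk G x y l → n G ≤ l → ∃[ l′ ] l′ < l × Walk G x y l′
shortcut p n≤l =
  let _ , _ , i<j , pᵢ≡pⱼ = pigeonhole (s≤s n≤l) (vertexAt p) in cutLoop p i<j pᵢ≡pⱼ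

shortenWalk : ∀ {G x y l} → Walk G x y l → ∃[ l′ ] l′ ≤ l × l′ < n G × Walk G x y l′
shortenWalk = go (<-wellFounded _)
  where
  go : ∀ {G x y l} → Acc _<_ l → Walk G x y l → ∃[ l′ ] l′ ≤ l × l′ < n G × Walk G x y l′
  go {G} {l = l} (acc rec) p with l <? n G
  ... | yes l<n = l , ≤-refl , l<n , p
  ... | no  l≮n =
    let l′ , l′<l , q = shortcut p (≮⇒≥ l≮n)
        l″ , l″≤l′ , l″<n , r = go (rec l′<l) q
    in l″ , ≤-trans l″≤l′ (<⇒≤ l′<l) , l″<n , r

search-sound : ∀ {G x y d} i f → search G x y i f ≡ just d → T (reach G d x y)
search-sound {G} {x} {y} i (suc f) eq with reach G i x y in rᵢ
search-sound i (suc f) refl | true  = subst T (sym rᵢ) _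
search-sound i (suc f) eq   | false = search-sound (suc i) f eq

search-least : ∀ {G x y d k} i f → search G x y i f ≡ just d → i ≤ k → k < d →
               ¬ T (reach G k x y)
search-least {G} {x} {y} i (suc f) eq i≤k k<d with reach G i x y in rᵢ
search-least i (suc f) refl i≤k k<i | true = ⊥-elim (<⇒≱ k<i i≤k)
search-least i (suc f) eq   i≤k k<d | false with m≤n⇒m<n∨m≡n i≤k
... | inj₁ i<k  = search-least (suc i) f eq i<k k<d
... | inj₂ refl = subst T rᵢ

search-complete : ∀ {G x y k} i f → T (reach G k x y) → i ≤ k → k < i + f →
                  ∃[ d ] search G x y i f ≡ just d
search-complete i zero _ i≤k k<i+0 =
  ⊥-elim (<⇒≱ (subst (_ <_) (+-identityʳ i) k<i+0) i≤k)
search-complete {G} {x} {y} {k} i (suc f) rₖ i≤k k<i+1+f with reach G i x y in rᵢ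
... | true  = i , refl
... | false with m≤n⇒m<n∨m≡n i≤k
...   | inj₁ i<k  = search-complete (suc i) f rₖ i<k (subst (k <_) (+-suc i f) k<i+1+f)
...   | inj₂ refl = ⊥-elim (subst T rᵢ rₖ)

dist-sound : ∀ {G x y d} → dist G x y ≡ just d → ∃[ l ] l ≤ d × Walk G x y l
dist-sound {G} {d = d} eq = reach-sound d (search-sound 0 (n G) eq)

dist-least : ∀ {G x y d l} → dist G x y ≡ just d → Walk G x y l → d ≤ l
dist-least {G} {d = d} {l} eq p with l <? d
... | yes l<d = ⊥-elim (search-least 0 (n G) eq z≤n l<d (reach-complete l p ≤-refl))
... | no  l≮d = ≮⇒≥ l≮d

-- dist only tries lengths below n G, hence the shortening first.
dist-complete : ∀ {G x y l} → Walk G x y l → ∃[ d ] d ≤ l × dist G x y ≡ just d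
dist-complete {G} p =
  let l′ , _ , l′<n , q = shortenWalk p
      d , eq = search-complete 0 (n G) (reach-complete l′ q ≤-refl) z≤n l′<n
  in d , dist-least eq p , eq

NoLongerWalks : (G : Graph) → V G → V G → (H : Graph) → V H → V H → Set
NoLongerWalks G x y H x′ y′ = ∀ {l} → Walk G x y l → ∃[ l′ ] l′ ≤ l × Walk H x′ y′ l′

dist-mono : ∀ {G H x y x′ y′ d d′} → NoLongerWalks G x y H x′ y′ →
            dist G x y ≡ just d → dist H x′ y′ ≡ just d′ → d′ ≤ d
dist-mono G⇒H eq eq′ =
  let _ , l≤d , p = dist-sound eq
      _ , l′≤l , q = G⇒H p
  in ≤-trans (dist-least eq′ q) (≤-trans l′≤l l≤d)

dist-finite : ∀ {G H x y x′ y′ d} → NoLongerWalks G x y H x′ y′ →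
              dist G x y ≡ just d → dist H x′ y′ ≢ nothing
dist-finite G⇒H eq eq′ =
  let _ , _ , p = dist-sound eq
      _ , _ , q = G⇒H p
      _ , _ , eq″ = dist-complete q
  in contradiction (trans (sym eq″) eq′) λ ()

dist-cong : ∀ {G H x y x′ y′} →
            NoLongerWalks G x y H x′ y′ → NoLongerWalks H x′ y′ G x y →
            dist G x y ≡ dist H x′ y′
dist-cong {G} {H} {x} {y} {x′} {y′} G⇒H H⇒G with dist G x y in eq | dist H x′ y′ in eq′
... | just d  | just d′ = cong just (≤-antisym (dist-mono H⇒G eq′ eq) (dist-mono G⇒H eq eq′))
... | just d  | nothing = ⊥-elim (dist-finite G⇒H eq eq′)
... | nothing | just d′ = ⊥-elim (dist-finite H⇒G eq′ eq)
... | nothing | nothing = refl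

-- DistanceCritical (mkGraph (suc m) a) unfolds to ∀ v → Critical a v.
Critical : ∀ {m} → (Fin (suc m) → Fin (suc m) → Bool) → Fin (suc m) → Set
Critical {m} a v =
  ∃[ i ] ∃[ j ] dist (mkGraph (suc m) a) (punchIn v i) (punchIn v j) ≢ dist (delete m a v) i j

HasDeterminingPair : (G : Graph) → V G → Set
HasDeterminingPair G v = ∃[ p ] ∃[ q ] DeterminingPair G p q v

determiningPair? : ∀ G (p q v : V G) → Dec (DeterminingPair G p q v)
determiningPair? G p q v =
  ¬? (p ≟ q) ×-dec (adj G p q ≟ᵇ false) ×-dec (adj G p v ≟ᵇ true) ×-dec
  (adj G q v ≟ᵇ true) ×-dec
  all? (λ w → (adj G p w ≟ᵇ true) →-dec (adj G q w ≟ᵇ true) →-dec (w ≟ v))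

hasDeterminingPair? : ∀ G (v : V G) → Dec (HasDeterminingPair G v)
hasDeterminingPair? G v = any? λ p → any? λ q → determiningPair? G p q v

inS? : ∀ G (u : V G) → Dec (InS G u)
inS? G u = any? λ w → any? λ v → determiningPair? G u w v

adj⇒¬nonAdj : ∀ {G x y} → Adj G x y → ¬ NonAdj G x y
adj⇒¬nonAdj x∼y x≁y = contradiction (trans (sym x∼y) x≁y) λ ()

adj⇒≢ : ∀ {G} → IsSimpleGraph G → ∀ {x y} → Adj G x y → x ≢ y
adj⇒≢ {G} (_ , irrefl) x∼x refl = adj⇒¬nonAdj {G} x∼x (irrefl _)

determiningPair-sym : ∀ {G} → IsSimpleGraph G → ∀ {p q v} →
                      DeterminingPair G p q v → DeterminingPair G q p v
determiningPair-sym (symm , _) {p} {q} (p≢q , p≁q , p∼v , q∼v , unique) =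
  p≢q ∘ sym , trans (symm q p) p≁q , q∼v , p∼v , λ w q∼w p∼w → unique w p∼w q∼w

module VertexDeletion {m : ℕ} (a : Fin (suc m) → Fin (suc m) → Bool) (v : Fin (suc m)) where

  G : Graph
  G = mkGraph (suc m) a

  G-v : Graph
  G-v = delete m a v

  walk-punchIn : ∀ {i j l} → Walk G-v i j l → Walk G (punchIn v i) (punchIn v j) l
  walk-punchIn []      = []
  walk-punchIn (e ∷ p) = e ∷ walk-punchIn p

  adj-punchOut : ∀ {u w} (v≢w : v ≢ w) → Adj G u w → Adj G u (punchIn v (punchOut v≢w))
  adj-punchOut {u} v≢w = subst (Adj G u) (sym (punchIn-punchOut v≢w))

  module _ (simple : IsSimpleGraph G) (no-pair : ¬ HasDeterminingPair G v) where

    detour : ∀ {i j} → Adj G (punchIn v i) v → Adj G v (punchIn v j) →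
             ∃[ l ] l ≤ 2 × Walk G-v i j l
    detour {i} {j} i∼v v∼j with i ≟ j
    ... | yes refl = 0 , z≤n , []
    ... | no i≢j with a (punchIn v i) (punchIn v j) in i∼j
    ...   | true = 1 , s≤s z≤n , i∼j ∷ []
    ...   | false with any? (λ w → (adj G-v i w ≟ᵇ true) ×-dec (adj G-v w j ≟ᵇ true))
    ...     | yes (w , i∼w , w∼j) = 2 , ≤-refl , i∼w ∷ w∼j ∷ []
    ...     | no no-common = ⊥-elim (no-pair (_ , _ , pair))
      where
      unique : ∀ w → Adj G (punchIn v i) w → Adj G (punchIn v j) w → w ≡ v
      unique w i∼w j∼w with v ≟ w
      ... | yes v≡w = sym v≡w
      ... | no  v≢w = ⊥-elim (no-common (punchOut v≢w , adj-punchOut v≢w i∼w ,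
                              trans (proj₁ simple _ _) (adj-punchOut v≢w j∼w)))

      pair : DeterminingPair G (punchIn v i) (punchIn v j) v
      pair = i≢j ∘ punchIn-injective v i j , i∼j , i∼v , trans (proj₁ simple _ _) v∼j , unique

    reroute : ∀ {s t i j l} → Walk G s t l → s ≡ punchIn v i → t ≡ punchIn v j →
              ∃[ l′ ] l′ ≤ l × Walk G-v i j l′
    reroute {i = i} {j} [] refl t≡j with punchIn-injective v i j t≡j
    ... | refl = 0 , z≤n , []
    reroute (_∷_ {z = z} s∼z p) refl t≡j with v ≟ z
    ... | no v≢z =
      let l′ , l′≤l , q = reroute p (sym (punchIn-punchOut v≢z)) t≡j
      in suc l′ , s≤s l′≤l , adj-punchOut v≢z s∼z ∷ q
    reroute {j = j} (s∼v ∷ []) refl t≡j | yes refl = ⊥-elim (punchInᵢ≢i v j (sym t≡j))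
    reroute (s∼v ∷ (v∼z ∷ p)) refl t≡j | yes refl =
      let v≢z = adj⇒≢ simple v∼z
          l₁ , l₁≤2 , q₁ = detour s∼v (adj-punchOut v≢z v∼z)
          l₂ , l₂≤l , q₂ = reroute p (sym (punchIn-punchOut v≢z)) t≡j
      in l₁ + l₂ , +-mono-≤ l₁≤2 l₂≤l , q₁ ++ q₂

    dist-unchanged : ∀ i j → dist G (punchIn v i) (punchIn v j) ≡ dist G-v i j
    dist-unchanged i j =
      dist-cong (λ p → reroute p refl refl) (λ q → _ , ≤-refl , walk-punchIn q)

  critical⇒hasDeterminingPair : IsSimpleGraph G → Critical a v → HasDeterminingPair G v
  critical⇒hasDeterminingPair simple (i , j , changed) =
    decidable-stable (hasDeterminingPair? G v) λ no-pair →
      changed (dist-unchanged simple no-pair i j)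

  determiningPair-far : IsSimpleGraph G → ∀ {i j l} →
                        DeterminingPair G (punchIn v i) (punchIn v j) v → Walk G-v i j l → 2 < l
  determiningPair-far _ (i≢j , _) [] = ⊥-elim (i≢j refl)
  determiningPair-far _ (_ , i≁j , _) (i∼j ∷ []) = ⊥-elim (adj⇒¬nonAdj {G} i∼j i≁j)
  determiningPair-far (symm , _) (_ , _ , _ , _ , unique) (_∷_ {z = w} i∼w (w∼j ∷ [])) =
    ⊥-elim (punchInᵢ≢i v w (unique _ i∼w (trans (symm _ _) w∼j)))
  determiningPair-far _ _ (_ ∷ _ ∷ _ ∷ _) = s≤s (s≤s (s≤s z≤n))

  determiningPair-dist-changes : IsSimpleGraph G → ∀ {i j} →
                                 DeterminingPair G (punchIn v i) (punchIn v j) v →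
                                 dist G (punchIn v i) (punchIn v j) ≢ dist G-v i j
  determiningPair-dist-changes simple@(symm , _) pair@(_ , _ , i∼v , j∼v , _) eq =
    let _ , d≤2 , eqG = dist-complete {G} (i∼v ∷ trans (symm _ _) j∼v ∷ [])
        _ , l≤d , q = dist-sound (trans (sym eq) eqG)
    in <⇒≱ (determiningPair-far simple pair q) (≤-trans l≤d d≤2)

  determiningPair⇒critical : IsSimpleGraph G → ∀ {p q} → DeterminingPair G p q v → Critical a v
  determiningPair⇒critical simple {p} {q} pair@(_ , _ , p∼v , q∼v , _) =
    punchOut v≢p , punchOut v≢q ,
    determiningPair-dist-changes simple (subst₂ (λ p q → DeterminingPair G p q v)
      (sym (punchIn-punchOut v≢p)) (sym (punchIn-punchOut v≢q)) pair)
    where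
    v≢p : v ≢ p
    v≢p = adj⇒≢ simple p∼v ∘ sym
    v≢q : v ≢ q
    v≢q = adj⇒≢ simple q∼v ∘ sym

open VertexDeletion using (critical⇒hasDeterminingPair; determiningPair⇒critical)

addEdge-adj : ∀ {G x y p} → p ≢ x → p ≢ y → ∀ w → adj (addEdge G x y) p w ≡ adj G p w
addEdge-adj {G} {x} {y} {p} p≢x p≢y w with p ≟ x | p ≟ y
... | yes p≡x | _       = ⊥-elim (p≢x p≡x)
... | no  _   | yes p≡y = ⊥-elim (p≢y p≡y)
... | no  _   | no  _   = ∨-identityʳ (adj G p w)

addEdge-simple : ∀ {G x y} → IsSimpleGraph G → x ≢ y → IsSimpleGraph (addEdge G x y)
addEdge-simple {G} {x} {y} (symm , irrefl) x≢y = symm′ , irrefl′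
  where
  symm′ : ∀ u w → adj (addEdge G x y) u w ≡ adj (addEdge G x y) w u
  symm′ u w = cong₂ _∨_ (symm u w) (trans (∨-comm (⌊ u ≟ x ⌋ ∧ ⌊ w ≟ y ⌋) _)
    (cong₂ _∨_ (∧-comm ⌊ u ≟ y ⌋ _) (∧-comm ⌊ u ≟ x ⌋ _)))

  irrefl′ : ∀ u → adj (addEdge G x y) u u ≡ false
  irrefl′ u with u ≟ x | u ≟ y
  ... | yes refl | yes refl = ⊥-elim (x≢y refl)
  ... | yes _    | no  _    = trans (∨-identityʳ _) (irrefl u)
  ... | no  _    | yes _    = trans (∨-identityʳ _) (irrefl u)
  ... | no  _    | no  _    = trans (∨-identityʳ _) (irrefl u)

addEdge-determiningPair : ∀ {G x y p q v} → p ≢ x → p ≢ y → q ≢ x → q ≢ y →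
                          DeterminingPair G p q v → DeterminingPair (addEdge G x y) p q v
addEdge-determiningPair {G} {x} {y} {p} {q} p≢x p≢y q≢x q≢y (p≢q , p≁q , p∼v , q∼v , unique) =
  p≢q , trans (p-adj _) p≁q , trans (p-adj _) p∼v , trans (q-adj _) q∼v ,
  λ w p∼w q∼w → unique w (trans (sym (p-adj w)) p∼w) (trans (sym (q-adj w)) q∼w)
  where
  p-adj : ∀ w → adj (addEdge G x y) p w ≡ adj G p w
  p-adj = addEdge-adj {G} p≢x p≢y
  q-adj : ∀ w → adj (addEdge G x y) q w ≡ adj G q w
  q-adj = addEdge-adj {G} q≢x q≢y

corollary5p5 : (G : Graph) → IsSimpleGraph G → EdgeMaximalDistanceCritical G →
    ∀ (x y : V G) → x ≢ y → NonAdj G x y → InS G x ⊎ InS G y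
corollary5p5 (mkGraph zero _) _ _ () _ _ _
corollary5p5 G@(mkGraph (suc m) a) simple (critical , maximal) x y x≢y x≁y
  with inS? G x | inS? G y
... | yes x∈S | _       = inj₁ x∈S
... | no  _   | yes y∈S = inj₂ y∈S
... | no  x∉S | no  y∉S = ⊥-elim (maximal x y x≢y x≁y G+xy-critical)
  where
  G+xy-critical : DistanceCritical (addEdge G x y)
  G+xy-critical v with critical⇒hasDeterminingPair a v simple (critical v)
  ... | p , q , pair = determiningPair⇒critical _ v (addEdge-simple simple x≢y)
    (addEdge-determiningPair (λ { refl → x∉S (q , v , pair) })  (λ { refl → y∉S (q , v , pair) })
                             (λ { refl → x∉S (p , v , pair′) }) (λ { refl → y∉S (p , v , pair′) })
                             pair)
    where
    pair′ : DeterminingPair G q p v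
    pair′ = determiningPair-sym simple pair
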